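{- Let $A$ be a setoid and $B$ a setoid family over $A$. The function $\mathsf{s}:(P_BW)_0\to W_0$, $(a,f)\mapsto\mathsf{s}\,(a,f)$, is extensional with respect to the equalities of $P_BW$ and $W$.
   Context: Setting: intensional Martin-Löf type theory with $\Pi$-types and a universe $\mathsf{U}$ closed under $\Pi$ and containing intensional $\Sigma$-types, identity types, the unit type, W-types and dependent W-types; logic is propositions-as-types. A setoid $X$ is a tuple $(X_0,\approx_X,r_X,s_X,t_X)$ with $X_0:\mathsf{U}$, $\approx_X:X_0\to X_0\to\mathsf{U}$ and witnesses of reflexivity, symmetry, transitivity; $x:X$ means $x:X_0$. An extensional function $f:X\Rightarrow Y$ is $f_0:X_0\to Y_0$ with a proof of $\prod_{x,x'}x\approx x'\to f_0x\approx f_0x'$; the setoid $X\Rightarrow Y$ has $f\approx g:=\prod_xf_0x\approx g_0x$. A setoid family $B$ over a setoid $A$ gives a setoid $B\,a$ (underlying type $B_0a$) for $a:A$ and extensional transports $B_\alpha:B\,a\Rightarrow B\,a'$ for $\alpha:a\approx_Aa'$, functorial up to $\approx$, with $B_\alpha\approx B_{\alpha'}$ for all $\alpha,\alpha':a\approx a'$. Write $b\approx_\alpha b'$ for $B_\alpha b\approx b'$. $P_BX$ is the setoid on $\sum_{a:A_0}(B\,a\Rightarrow X)$ with $(a,k)\approx(a',k'):=\sum_{\alpha:a\approx a'}k\approx k'\circ B_\alpha$. $\mathrm{W}$ is the W-type on $A_0,B_0$ with constructor $\mathsf{sup}$, and $\mathsf{n}(\mathsf{sup}\,a\,f)\equiv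 a$, $\mathsf{b}(\mathsf{sup}\,a\,f)\equiv f$. $\mathcal{W}_B$ is the inductive family on $\mathrm{W}\times\mathrm{W}$ with single constructor $\mathsf{dsup}\,(w,w')\,\alpha\,\phi:\mathcal{W}_B\,w\,w'$ for $\alpha:\mathsf{n}w\approx_A\mathsf{n}w'$ and $\phi:\prod_{(b,b',\beta):\sum_{b,b'}b\approx_\alpha b'}\mathcal{W}_B(\mathsf{b}\,w\,b)(\mathsf{b}\,w'\,b')$. The setoid $W$ has underlying type $\sum_w\mathcal{W}_B\,w\,w$ and $(w,\_)\approx_W(w',\_):=\mathcal{W}_B\,w\,w'$. For $a:A$ and $f:B\,a\Rightarrow W$, $\mathsf{s}\,(a,f):W$ is the tree $\mathsf{sup}\,a\,(\lambda b.\mathrm{pr}_1(f_0\,b))$ together with a proof that it is extensional (that $\mathcal{W}_B$ of it with itself is inhabited). -}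

module Defs where

open import Level using (0ℓ)
open import Data.Product using (Σ; Σ-syntax; _,_; proj₁; proj₂)
open import Relation.Binary.Bundles using (Setoid)
open import Function.Bundles using (Func)

-- The universe U is Agda's Set (= Set 0ℓ).  A setoid is a stdlib
-- Setoid 0ℓ 0ℓ: carrier X₀ : Set, relation X₀ → X₀ → Set, and proofs of
-- reflexivity, symmetry, transitivity.
SetoidU : Set₁
SetoidU = Setoid 0ℓ 0ℓ

-- Extensional functions X ⇒ Y (f₀ = Func.to, extensionality = Func.cong).
_⇒_ : SetoidU → SetoidU → Set
X ⇒ Y = Func X Y

_≈⇒_ : {X Y : SetoidU} → X ⇒ Y → X ⇒ Y → Set
_≈⇒_ {X} {Y} f g = (x : Setoid.Carrier X) → Setoid._≈_ Y (Func.to f x) (Func.to g x)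

id⇒ : (X : SetoidU) → X ⇒ X
id⇒ X = record { to = λ x → x ; cong = λ e → e }

_∘⇒_ : {X Y Z : SetoidU} → Y ⇒ Z → X ⇒ Y → X ⇒ Z
g ∘⇒ f = record { to = λ x → Func.to g (Func.to f x)
                ; cong = λ e → Func.cong g (Func.cong f e) }

record Family (A : SetoidU) : Set₁ where
  open Setoid A renaming (Carrier to A₀; _≈_ to _≈A_)
  field
    fib   : A₀ → SetoidU
    tr    : {a a' : A₀} → a ≈A a' → fib a ⇒ fib a'
    tr-refl  : {a : A₀} → _≈⇒_ {fib a} {fib a} (tr (Setoid.refl A)) (id⇒ (fib a))
    tr-trans : {a a' a'' : A₀} (α : a ≈A a') (α' : a' ≈A a'') →
               _≈⇒_ {fib a} {fib a''} (tr (Setoid.trans A α α')) (tr α' ∘⇒ tr α)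
    tr-irr   : {a a' : A₀} (α α' : a ≈A a') → _≈⇒_ {fib a} {fib a'} (tr α) (tr α')

  B₀ : A₀ → Set
  B₀ a = Setoid.Carrier (fib a)

  _≈[_]_ : {a a' : A₀} → B₀ a → a ≈A a' → B₀ a' → Set
  b ≈[ α ] b' = Setoid._≈_ (fib _) (Func.to (tr α) b) b'

data W-type (A₀ : Set) (B₀ : A₀ → Set) : Set where
  sup : (a : A₀) → (B₀ a → W-type A₀ B₀) → W-type A₀ B₀

module WSetoid {A : SetoidU} (B : Family A) where
  open Setoid A renaming (Carrier to A₀; _≈_ to _≈A_)
  open Family B

  W₀ : Set
  W₀ = W-type A₀ B₀

  n : W₀ → A₀
  n (sup a f) = a

  b : (w : W₀) → B₀ (n w) → W₀
  b (sup a f) = f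

  data 𝒲 : W₀ → W₀ → Set where
    dsup : (w w' : W₀) (α : n w ≈A n w') →
           ((t : Σ[ x ∈ B₀ (n w) ] Σ[ x' ∈ B₀ (n w') ] (x ≈[ α ] x')) →
             𝒲 (b w (proj₁ t)) (b w' (proj₁ (proj₂ t)))) →
           𝒲 w w'

  Wc : Set
  Wc = Σ[ w ∈ W₀ ] 𝒲 w w

  _≈W_ : Wc → Wc → Set
  (w , _) ≈W (w' , _) = 𝒲 w w'

  private
    module Bf {a : A₀} = Setoid (fib a)

    𝒲-sym : {w w' : W₀} → 𝒲 w w' → 𝒲 w' w
    𝒲-sym (dsup w w' α φ) =
      dsup w' w (Setoid.sym A α) λ { (x' , x , β) →
        𝒲-sym (φ (x , x' ,
          Bf.trans (Func.cong (tr α) (Bf.sym β))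
            (Bf.trans (Bf.sym (tr-trans (Setoid.sym A α) α x'))
              (Bf.trans (tr-irr _ (Setoid.refl A) x') (tr-refl x'))))) }

    𝒲-trans : {w w' w'' : W₀} → 𝒲 w w' → 𝒲 w' w'' → 𝒲 w w''
    𝒲-trans (dsup w w' α φ) (dsup .w' w'' α' ψ) =
      dsup w w'' (Setoid.trans A α α') λ { (x , x'' , β) →
        𝒲-trans (φ (x , Func.to (tr α) x , Bf.refl))
                (ψ (Func.to (tr α) x , x'' ,
                    Bf.trans (Bf.sym (tr-trans α α' x)) β)) }

  W : SetoidU
  W = record
    { Carrier = Wc
    ; _≈_ = _≈W_
    ; isEquivalence = record
      { refl  = λ {p} → proj₂ p
      ; sym   = 𝒲-sym
      ; trans = 𝒲-trans } }

  P₀ : SetoidU → Set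
  P₀ X = Σ[ a ∈ A₀ ] (fib a ⇒ X)

  _≈P_ : {X : SetoidU} → P₀ X → P₀ X → Set
  _≈P_ {X} (a , k) (a' , k') =
    Σ[ α ∈ a ≈A a' ] (_≈⇒_ {fib a} {X} k (k' ∘⇒ tr α))

  s : P₀ W → Wc
  s (a , f) = sup a (λ x → proj₁ (Func.to f x)) ,
    dsup _ _ (Setoid.refl A) λ { (x , x' , β) →
      Func.cong f (Bf.trans (Bf.sym (tr-refl x)) β) }

module Submission where

-- Two trees sup a g and sup a' g' are related in 𝒲 as soon as there is a
-- node equality α : a ≈ a' such that g and g' send α-related positions to
-- 𝒲-related subtrees; this is just the constructor dsup read as an
-- introduction rule (sup-cong).  For s (a , f) and s (a' , f') the branch
-- functions are the first projections of f and f', so it suffices that f and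
-- f' map α-related positions to ≈W-related elements of W.  This follows from
-- the P_B W equality (α , e), where e : f ≈ f' ∘ B_α: for b ≈_α b' we have
-- f b ≈ f' (B_α b) ≈ f' b', the second step by extensionality of f'
-- (congruence-along).

open import Defs
open import Relation.Binary.Bundles using (Setoid)
open import Data.Product using (_,_)
open import Function.Bundles using (Func)

module _ {A : SetoidU} (B : Family A) where
  open Setoid A renaming (Carrier to A₀; _≈_ to _≈A_)
  open Family B
  open WSetoid B

  sup-cong : {a a' : A₀} {g : B₀ a → W₀} {g' : B₀ a' → W₀} (α : a ≈A a') →
             ((x : B₀ a) (x' : B₀ a') → x ≈[ α ] x' → 𝒲 (g x) (g' x')) →
             𝒲 (sup a g) (sup a' g')
  sup-cong α related = dsup _ _ α λ { (x , x' , β) → related x x' β }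

  congruence-along : {X : SetoidU} {a a' : A₀} {k : fib a ⇒ X} {k' : fib a' ⇒ X} →
                     ((α , _) : _≈P_ {X} (a , k) (a' , k')) →
                     (x : B₀ a) (x' : B₀ a') → x ≈[ α ] x' →
                     Setoid._≈_ X (Func.to k x) (Func.to k' x')
  congruence-along {X} {k' = k'} (α , e) x x' β =
    Setoid.trans X (e x) (Func.cong k' β)

lemma3p5 : (A : SetoidU) (B : Family A) →
    let open WSetoid B in
    (p p' : P₀ W) → _≈P_ {W} p p' → s p ≈W s p'
lemma3p5 A B (a , f) (a' , f') (α , e) =
  sup-cong B α (congruence-along B {WSetoid.W B} {k = f} {k' = f'} (α , e))
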